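{- Let $P_n$ denote the path graph on $n$ vertices and let $AD(P_n)$ be its adjacency-diametrical matrix. For each $k\ge 1$ put $\Phi_k(x)=\prod_{j=1}^{k}\left(x-2\cos\frac{\pi j}{k+1}\right)$. (i) The characteristic polynomial $\det(xI-AD(P_2))$ equals $x^2-1$. (ii) For $n\ge 3$, the characteristic polynomial $\det(xI_n-AD(P_n))$ equals \[\Phi_n(x)-(n-1)^2\,\Phi_{n-2}(x)+2(1-n).\]
   Context: All graphs are finite, simple and undirected. For a connected graph $G$ with vertex set $\{v_1,\dots,v_n\}$ and diameter $d$, let $d_G(u,v)$ be the distance between $u$ and $v$. The adjacency-diametrical matrix $AD(G)$ is the $n\times n$ matrix whose $(i,j)$-entry is $1$ if $d_G(v_i,v_j)=1$, is $d$ if $d_G(v_i,v_j)=d$, and is $0$ otherwise. (Note $\Phi_k$ is the characteristic polynomial of the adjacency matrix of $P_k$.) -}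

module Defs where

open import Data.Bool using (if_then_else_)
open import Data.Nat using (ℕ; zero; suc; ∣_-_∣; _≡ᵇ_; _⊔_)
open import Data.Integer using (ℤ; +_; -_; _+_; _-_; _*_)
open import Data.Fin using (Fin; zero; suc; toℕ; punchIn)
open import Data.Fin.Properties using (_≟_)
open import Relation.Nullary.Decidable using (⌊_⌋)

Mat : ℕ → Set
Mat n = Fin n → Fin n → ℤ

sumFin : ∀ n → (Fin n → ℤ) → ℤ
sumFin zero    f = + 0
sumFin (suc n) f = f zero + sumFin n (λ i → f (suc i))

maxFin : ∀ n → (Fin n → ℕ) → ℕ
maxFin zero    f = 0
maxFin (suc n) f = f zero ⊔ maxFin n (λ i → f (suc i))

sgn : ℕ → ℤ
sgn zero    = + 1
sgn (suc k) = - sgn k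

det : ∀ n → Mat n → ℤ
det zero    M = + 1
det (suc n) M =
  sumFin (suc n) (λ j → sgn (toℕ j) * M zero j * det n (λ r c → M (suc r) (punchIn j c)))

charPoly : ∀ n → Mat n → ℤ → ℤ
charPoly n M x = det n (λ i j → (if ⌊ i ≟ j ⌋ then x else + 0) - M i j)

diameter : ∀ n → (Fin n → Fin n → ℕ) → ℕ
diameter n D = maxFin n (λ i → maxFin n (λ j → D i j))

AD : ∀ n → (Fin n → Fin n → ℕ) → Mat n
AD n D i j =
  if D i j ≡ᵇ 1 then + 1
  else (if D i j ≡ᵇ diameter n D then + diameter n D else + 0)

-- Path graph P_n on vertices 0,…,n-1 (i ~ i+1): its distance function.
pathDist : ∀ n → Fin n → Fin n → ℕ
pathDist n i j = ∣ toℕ i - toℕ j ∣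

pathAdj : ∀ n → Mat n
pathAdj n i j = if pathDist n i j ≡ᵇ 1 then + 1 else + 0

Φ : ℕ → ℤ → ℤ
Φ k x = charPoly k (pathAdj k) x

-- Put N = d + 1 with d ≥ 2. Every entry of xI − AD(P_N) depends only on the distance
-- |i − j|, and the matrix is xI − A(P_N) with c = −d added at the corners (0, d) and (d, 0).
-- Splitting the determinant additively in the first column and then in the first row
-- isolates det(xI − A(P_N)) = Φ_N; each remaining piece has a single nonzero entry c in its
-- first row or column, and the corresponding minor is either triangular with diagonal −1 or
-- again xI − A(P_{N−2}). Collecting the signs gives Φ_N − c² Φ_{N−2} + 2c.
module Submission where

open import Defs
open import Data.Bool as Bool using (true; false; if_then_else_)
open import Data.Empty using (⊥-elim)
open import Data.Fin using (Fin; zero; suc; toℕ; punchIn; fromℕ)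
open import Data.Fin.Properties using (toℕ-fromℕ; toℕ<n; toℕ-injective; suc-injective; _≟_)
open import Data.Integer using (ℤ; +_; -_; _+_; _-_; _*_; _^_)
import Data.Integer.Properties as ℤ
open import Data.Integer.Tactic.RingSolver using (solve-∀)
open import Data.Nat as ℕ using (ℕ; zero; suc; _≤_; _<_; _∸_; s≤s; z<s; ∣_-_∣; _≡ᵇ_)
import Data.Nat.Properties as ℕ
open import Data.Product using (_×_; _,_)
open import Function using (_∘_)
open import Relation.Binary.PropositionalEquality
open import Relation.Nullary.Decidable using (⌊_⌋; yes; no)

sumFin-cong : ∀ n {f g : Fin n → ℤ} → (∀ i → f i ≡ g i) → sumFin n f ≡ sumFin n g
sumFin-cong zero    f≗g = refl
sumFin-cong (suc n) f≗g = cong₂ _+_ (f≗g zero) (sumFin-cong n (f≗g ∘ suc))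

sumFin-zero : ∀ n {f : Fin n → ℤ} → (∀ i → f i ≡ + 0) → sumFin n f ≡ + 0
sumFin-zero zero    f≗0 = refl
sumFin-zero (suc n) f≗0 = cong₂ _+_ (f≗0 zero) (sumFin-zero n (f≗0 ∘ suc))

sumFin-single : ∀ n {f : Fin n → ℤ} k → (∀ i → i ≢ k → f i ≡ + 0) → sumFin n f ≡ f k
sumFin-single (suc n) {f} zero f≗0 = begin
  f zero + sumFin n (f ∘ suc) ≡⟨ cong (_+_ (f zero)) (sumFin-zero n (λ i → f≗0 (suc i) λ ())) ⟩
  f zero + + 0                ≡⟨ ℤ.+-identityʳ (f zero) ⟩
  f zero                      ∎
  where open ≡-Reasoning
sumFin-single (suc n) {f} (suc k) f≗0 = begin
  f zero + sumFin n (f ∘ suc) ≡⟨ cong₂ _+_ (f≗0 zero λ ()) (sumFin-single n k λ i i≢k → f≗0 (suc i) (i≢k ∘ suc-injective)) ⟩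
  + 0 + f (suc k)             ≡⟨ ℤ.+-identityˡ (f (suc k)) ⟩
  f (suc k)                   ∎
  where open ≡-Reasoning

sumFin-+ : ∀ n (f g : Fin n → ℤ) → sumFin n (λ i → f i + g i) ≡ sumFin n f + sumFin n g
sumFin-+ zero    f g = refl
sumFin-+ (suc n) f g = begin
  (f zero + g zero) + sumFin n (λ i → f (suc i) + g (suc i))
    ≡⟨ cong (_+_ (f zero + g zero)) (sumFin-+ n (f ∘ suc) (g ∘ suc)) ⟩
  (f zero + g zero) + (sumFin n (f ∘ suc) + sumFin n (g ∘ suc))
    ≡⟨ interchange (f zero) (g zero) _ _ ⟩
  (f zero + sumFin n (f ∘ suc)) + (g zero + sumFin n (g ∘ suc)) ∎
  where
  open ≡-Reasoning
  interchange : ∀ a b c d → (a + b) + (c + d) ≡ (a + c) + (b + d)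
  interchange = solve-∀

sumFin-*ˡ : ∀ n a (f : Fin n → ℤ) → sumFin n (λ i → a * f i) ≡ a * sumFin n f
sumFin-*ˡ zero    a f = sym (ℤ.*-zeroʳ a)
sumFin-*ˡ (suc n) a f = begin
  a * f zero + sumFin n (λ i → a * f (suc i)) ≡⟨ cong (_+_ (a * f zero)) (sumFin-*ˡ n a (f ∘ suc)) ⟩
  a * f zero + a * sumFin n (f ∘ suc)         ≡⟨ ℤ.*-distribˡ-+ a (f zero) _ ⟨
  a * (f zero + sumFin n (f ∘ suc))           ∎
  where open ≡-Reasoning

sgn-*-sgn : ∀ n → sgn n * sgn n ≡ + 1
sgn-*-sgn zero    = refl
sgn-*-sgn (suc n) = trans (neg-square (sgn n)) (sgn-*-sgn n)
  where
  neg-square : ∀ a → (- a) * (- a) ≡ a * a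
  neg-square = solve-∀

-1^n≡sgn : ∀ n → (- + 1) ^ n ≡ sgn n
-1^n≡sgn zero    = refl
-1^n≡sgn (suc n) = trans (ℤ.-1*i≡-i _) (cong -_ (-1^n≡sgn n))

*-zero-middle : ∀ a {b} c → b ≡ + 0 → a * b * c ≡ + 0
*-zero-middle a c refl = trans (cong (_* c) (ℤ.*-zeroʳ a)) (ℤ.*-zeroˡ c)

minor : ∀ {n} → Fin (suc n) → Fin (suc n) → Mat (suc n) → Mat n
minor i j M r c = M (punchIn i r) (punchIn j c)

laplaceTerm : ∀ n → Mat (suc n) → Fin (suc n) → ℤ
laplaceTerm n M j = sgn (toℕ j) * M zero j * det n (minor zero j M)

det-cong : ∀ n (M N : Mat n) → (∀ i j → M i j ≡ N i j) → det n M ≡ det n N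
det-cong zero    M N M≗N = refl
det-cong (suc n) M N M≗N = sumFin-cong (suc n) λ j →
  cong₂ (λ m d → sgn (toℕ j) * m * d) (M≗N zero j) (det-cong n _ _ λ r c → M≗N (suc r) (punchIn j c))

det-row₀-single : ∀ n (M : Mat (suc n)) k → (∀ j → j ≢ k → M zero j ≡ + 0) →
  det (suc n) M ≡ sgn (toℕ k) * M zero k * det n (minor zero k M)
det-row₀-single n M k row₀≗0 = sumFin-single (suc n) {laplaceTerm n M} k λ j j≢k →
  *-zero-middle (sgn (toℕ j)) (det n (minor zero j M)) (row₀≗0 j j≢k)

det-col₀-single : ∀ n (M : Mat (suc n)) r → (∀ i → i ≢ r → M i zero ≡ + 0) →
  det (suc n) M ≡ sgn (toℕ r) * M r zero * det n (minor r zero M)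
det-col₀-single zero    M zero col₀≗0 = ℤ.+-identityʳ _
det-col₀-single (suc n) M zero col₀≗0 = sumFin-single (suc (suc n)) {laplaceTerm (suc n) M} zero vanish
  where
  vanish : ∀ j → j ≢ zero → laplaceTerm (suc n) M j ≡ + 0
  vanish zero    0≢0 = ⊥-elim (0≢0 refl)
  vanish (suc k) _   = trans (cong (sgn (suc (toℕ k)) * M zero (suc k) *_) minor≡0)
                              (ℤ.*-zeroʳ (sgn (suc (toℕ k)) * M zero (suc k)))
    where
    minor≡0 : det (suc n) (minor zero (suc k) M) ≡ + 0
    minor≡0 = trans (det-col₀-single n (minor zero (suc k) M) zero λ i _ → col₀≗0 (suc i) λ ())
                    (*-zero-middle (+ 1) (det n (minor zero zero (minor zero (suc k) M))) (col₀≗0 (suc zero) λ ()))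
-- Expanding every minor along its first column (induction) pulls the common factor
-- sgn (suc r) * q out of all Laplace terms.
det-col₀-single (suc n) M (suc r) col₀≗0 = begin
  laplaceTerm (suc n) M zero + sumFin (suc n) (laplaceTerm (suc n) M ∘ suc)
    ≡⟨ cong₂ _+_ (*-zero-middle (+ 1) (det (suc n) (minor zero zero M)) (col₀≗0 zero λ ())) (sumFin-cong (suc n) expand) ⟩
  + 0 + sumFin (suc n) (λ k → sgn (suc (toℕ r)) * q * laplaceTerm n N k)
    ≡⟨ ℤ.+-identityˡ _ ⟩
  sumFin (suc n) (λ k → sgn (suc (toℕ r)) * q * laplaceTerm n N k)
    ≡⟨ sumFin-*ˡ (suc n) (sgn (suc (toℕ r)) * q) (laplaceTerm n N) ⟩
  sgn (suc (toℕ r)) * q * det (suc n) N ∎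
  where
  open ≡-Reasoning
  q : ℤ
  q = M (suc r) zero
  N : Mat (suc n)
  N = minor (suc r) zero M
  swap : ∀ s a t q d → (- s) * a * (t * q * d) ≡ (- t) * q * (s * a * d)
  swap = solve-∀
  expand : ∀ k → laplaceTerm (suc n) M (suc k) ≡ sgn (suc (toℕ r)) * q * laplaceTerm n N k
  expand k = trans
    (cong (sgn (suc (toℕ k)) * M zero (suc k) *_)
          (det-col₀-single n (minor zero (suc k) M) r λ i i≢r → col₀≗0 (suc i) (i≢r ∘ suc-injective)))
    (swap (sgn (toℕ k)) (M zero (suc k)) (sgn (toℕ r)) q (det n (minor zero k N)))

det-row₀-additive : ∀ n (M A B : Mat (suc n)) →
  (∀ j → M zero j ≡ A zero j + B zero j) →
  (∀ i j → M (suc i) j ≡ A (suc i) j) → (∀ i j → M (suc i) j ≡ B (suc i) j) →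
  det (suc n) M ≡ det (suc n) A + det (suc n) B
det-row₀-additive n M A B row₀ M≗A M≗B =
  trans (sumFin-cong (suc n) split) (sumFin-+ (suc n) (laplaceTerm n A) (laplaceTerm n B))
  where
  distrib : ∀ s a b d → s * (a + b) * d ≡ s * a * d + s * b * d
  distrib = solve-∀
  split : ∀ j → laplaceTerm n M j ≡ laplaceTerm n A j + laplaceTerm n B j
  split j = let s = sgn (toℕ j) ; d = det n (minor zero j M) in begin
    s * M zero j * d                       ≡⟨ cong (λ m → s * m * d) (row₀ j) ⟩
    s * (A zero j + B zero j) * d          ≡⟨ distrib s (A zero j) (B zero j) d ⟩
    s * A zero j * d + s * B zero j * d    ≡⟨ cong₂ (λ a b → s * A zero j * a + s * B zero j * b)
                                                  (det-cong n _ _ λ r c → M≗A r (punchIn j c))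
                                                  (det-cong n _ _ λ r c → M≗B r (punchIn j c)) ⟩
    laplaceTerm n A j + laplaceTerm n B j  ∎
    where open ≡-Reasoning

mutual
  det-col₀-additive : ∀ n (M A B : Mat (suc n)) →
    (∀ i → M i zero ≡ A i zero + B i zero) →
    (∀ i j → M i (suc j) ≡ A i (suc j)) → (∀ i j → M i (suc j) ≡ B i (suc j)) →
    det (suc n) M ≡ det (suc n) A + det (suc n) B
  det-col₀-additive n M A B col₀ M≗A M≗B =
    trans (sumFin-cong (suc n) (laplaceTerm-col₀-additive n M A B col₀ M≗A M≗B))
          (sumFin-+ (suc n) (laplaceTerm n A) (laplaceTerm n B))

  laplaceTerm-col₀-additive : ∀ n (M A B : Mat (suc n)) →
    (∀ i → M i zero ≡ A i zero + B i zero) →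
    (∀ i j → M i (suc j) ≡ A i (suc j)) → (∀ i j → M i (suc j) ≡ B i (suc j)) →
    ∀ j → laplaceTerm n M j ≡ laplaceTerm n A j + laplaceTerm n B j
  laplaceTerm-col₀-additive n M A B col₀ M≗A M≗B zero = begin
    + 1 * M zero zero * d                               ≡⟨ cong (λ m → + 1 * m * d) (col₀ zero) ⟩
    + 1 * (A zero zero + B zero zero) * d               ≡⟨ distribˡ (A zero zero) (B zero zero) d ⟩
    + 1 * A zero zero * d + + 1 * B zero zero * d       ≡⟨ cong₂ (λ a b → + 1 * A zero zero * a + + 1 * B zero zero * b)
                                                             (det-cong n _ _ λ r c → M≗A (suc r) c)
                                                             (det-cong n _ _ λ r c → M≗B (suc r) c) ⟩
    laplaceTerm n A zero + laplaceTerm n B zero         ∎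
    where
    open ≡-Reasoning
    d : ℤ
    d = det n (minor zero zero M)
    distribˡ : ∀ a b d → + 1 * (a + b) * d ≡ + 1 * a * d + + 1 * b * d
    distribˡ = solve-∀
  laplaceTerm-col₀-additive (suc n) M A B col₀ M≗A M≗B (suc k) = begin
    s * M zero (suc k) * det (suc n) Mₖ
      ≡⟨ cong (s * M zero (suc k) *_)
              (det-col₀-additive n Mₖ Aₖ Bₖ (col₀ ∘ suc) (λ i j → M≗A (suc i) (punchIn k j))
                                                    (λ i j → M≗B (suc i) (punchIn k j))) ⟩
    s * M zero (suc k) * (det (suc n) Aₖ + det (suc n) Bₖ)
      ≡⟨ distribʳ s (M zero (suc k)) (det (suc n) Aₖ) (det (suc n) Bₖ) ⟩
    s * M zero (suc k) * det (suc n) Aₖ + s * M zero (suc k) * det (suc n) Bₖ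
      ≡⟨ cong₂ (λ a b → s * a * det (suc n) Aₖ + s * b * det (suc n) Bₖ) (M≗A zero k) (M≗B zero k) ⟩
    laplaceTerm (suc n) A (suc k) + laplaceTerm (suc n) B (suc k) ∎
    where
    open ≡-Reasoning
    s : ℤ
    s = sgn (suc (toℕ k))
    Mₖ Aₖ Bₖ : Mat (suc n)
    Mₖ = minor zero (suc k) M
    Aₖ = minor zero (suc k) A
    Bₖ = minor zero (suc k) B
    distribʳ : ∀ s m a b → s * m * (a + b) ≡ s * m * a + s * m * b
    distribʳ = solve-∀

det-lowerTriangular : ∀ n (M : Mat n) a → (∀ i j → toℕ i < toℕ j → M i j ≡ + 0) →
  (∀ i → M i i ≡ a) → det n M ≡ a ^ n
det-lowerTriangular zero    M a upper≗0 diag≗a = refl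
det-lowerTriangular (suc n) M a upper≗0 diag≗a = begin
  det (suc n) M
    ≡⟨ det-row₀-single n M zero row₀≗0 ⟩
  + 1 * M zero zero * det n (minor zero zero M)
    ≡⟨ cong₂ _*_ (trans (ℤ.*-identityˡ (M zero zero)) (diag≗a zero))
                 (det-lowerTriangular n (minor zero zero M) a
                    (λ i j i<j → upper≗0 (suc i) (suc j) (s≤s i<j)) (diag≗a ∘ suc)) ⟩
  a * a ^ n ∎
  where
  open ≡-Reasoning
  row₀≗0 : ∀ j → j ≢ zero → M zero j ≡ + 0
  row₀≗0 zero    0≢0 = ⊥-elim (0≢0 refl)
  row₀≗0 (suc j) _   = upper≗0 zero (suc j) z<s

det-upperTriangular : ∀ n (M : Mat n) a → (∀ i j → toℕ j < toℕ i → M i j ≡ + 0) →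
  (∀ i → M i i ≡ a) → det n M ≡ a ^ n
det-upperTriangular zero    M a lower≗0 diag≗a = refl
det-upperTriangular (suc n) M a lower≗0 diag≗a = begin
  det (suc n) M
    ≡⟨ det-col₀-single n M zero col₀≗0 ⟩
  + 1 * M zero zero * det n (minor zero zero M)
    ≡⟨ cong₂ _*_ (trans (ℤ.*-identityˡ (M zero zero)) (diag≗a zero))
                 (det-upperTriangular n (minor zero zero M) a
                    (λ i j j<i → lower≗0 (suc i) (suc j) (s≤s j<i)) (diag≗a ∘ suc)) ⟩
  a * a ^ n ∎
  where
  open ≡-Reasoning
  col₀≗0 : ∀ i → i ≢ zero → M i zero ≡ + 0
  col₀≗0 zero    0≢0 = ⊥-elim (0≢0 refl)
  col₀≗0 (suc i) _   = lower≗0 (suc i) zero z<s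

det-2 : (M : Mat 2) →
  det 2 M ≡ M zero zero * M (suc zero) (suc zero) - M zero (suc zero) * M (suc zero) zero
det-2 M = expand (M zero zero) (M zero (suc zero)) (M (suc zero) zero) (M (suc zero) (suc zero))
  where
  -- The left-hand side is det 2 M unfolded by the definition of det.
  expand : ∀ a b c e → + 1 * a * (+ 1 * e * + 1 + + 0) + (- + 1 * b * (+ 1 * c * + 1 + + 0) + + 0) ≡ a * e - b * c
  expand = solve-∀

toℕ-punchIn-fromℕ : ∀ {n} (i : Fin n) → toℕ (punchIn (fromℕ n) i) ≡ toℕ i
toℕ-punchIn-fromℕ zero    = refl
toℕ-punchIn-fromℕ (suc i) = cong suc (toℕ-punchIn-fromℕ i)

∣n-1+n∣≡1 : ∀ n → ∣ n - suc n ∣ ≡ 1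
∣n-1+n∣≡1 zero    = refl
∣n-1+n∣≡1 (suc n) = ∣n-1+n∣≡1 n

2+m≤n⇒2≤∣m-n∣ : ∀ {m n} → 2 ℕ.+ m ≤ n → 2 ≤ ∣ m - n ∣
2+m≤n⇒2≤∣m-n∣ {zero}            2≤n        = 2≤n
2+m≤n⇒2≤∣m-n∣ {suc m} {suc n} (s≤s 2+m≤n) = 2+m≤n⇒2≤∣m-n∣ 2+m≤n

∣i-j∣<n : ∀ {n} (i j : Fin n) → ∣ toℕ i - toℕ j ∣ < n
∣i-j∣<n i j = ℕ.≤-<-trans (ℕ.∣m-n∣≤m⊔n (toℕ i) (toℕ j)) (ℕ.⊔-lub (toℕ<n i) (toℕ<n j))

⌊i≟j⌋≡∣i-j∣≡ᵇ0 : ∀ {n} (i j : Fin n) → ⌊ i ≟ j ⌋ ≡ (∣ toℕ i - toℕ j ∣ ≡ᵇ 0)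
⌊i≟j⌋≡∣i-j∣≡ᵇ0 i j with i ≟ j
... | yes refl rewrite ℕ.∣n-n∣≡0 (toℕ i) = refl
... | no i≢j with ∣ toℕ i - toℕ j ∣ in eq
...   | zero  = ⊥-elim (i≢j (toℕ-injective (ℕ.∣m-n∣≡0⇒m≡n eq)))
...   | suc _ = refl

maxFin-lub : ∀ n (f : Fin n → ℕ) {b} → (∀ i → f i ≤ b) → maxFin n f ≤ b
maxFin-lub zero    f f≤b = ℕ.z≤n
maxFin-lub (suc n) f f≤b = ℕ.⊔-lub (f≤b zero) (maxFin-lub n (f ∘ suc) (f≤b ∘ suc))

f≤maxFin : ∀ n (f : Fin n → ℕ) i → f i ≤ maxFin n f
f≤maxFin (suc n) f zero    = ℕ.m≤m⊔n (f zero) _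
f≤maxFin (suc n) f (suc i) = ℕ.≤-trans (f≤maxFin n (f ∘ suc) i) (ℕ.m≤n⊔m (f zero) _)

diameter-path : ∀ m → diameter (suc m) (pathDist (suc m)) ≡ m
diameter-path m = ℕ.≤-antisym
  (maxFin-lub (suc m) _ λ i → maxFin-lub (suc m) _ λ j → ℕ.s≤s⁻¹ (∣i-j∣<n i j))
  (ℕ.≤-trans (subst (_≤ maxFin (suc m) toℕ) (toℕ-fromℕ m) (f≤maxFin (suc m) toℕ (fromℕ m)))
             (f≤maxFin (suc m) (λ i → maxFin (suc m) (pathDist (suc m) i)) zero))

symToeplitz : ∀ {n} → (ℕ → ℤ) → Mat n
symToeplitz f i j = f ∣ toℕ i - toℕ j ∣

pathEntry : ℤ → ℕ → ℤ
pathEntry x 0             = x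
pathEntry x 1             = - + 1
pathEntry x (suc (suc _)) = + 0

pathEntry-≥2 : ∀ x {D} → 2 ≤ D → pathEntry x D ≡ + 0
pathEntry-≥2 x (s≤s (s≤s _)) = refl

Φ≡det-pathEntry : ∀ n x → Φ n x ≡ det n (symToeplitz (pathEntry x))
Φ≡det-pathEntry n x = det-cong n _ _ λ i j →
  trans (cong (λ b → (if b then x else + 0) - pathAdj n i j) (⌊i≟j⌋≡∣i-j∣≡ᵇ0 i j))
        (entry ∣ toℕ i - toℕ j ∣)
  where
  entry : ∀ D → (if D ≡ᵇ 0 then x else + 0) - (if D ≡ᵇ 1 then + 1 else + 0) ≡ pathEntry x D
  entry 0             = ℤ.+-identityʳ x
  entry 1             = refl
  entry (suc (suc _)) = refl

cornerEntry : ℕ → ℤ → ℕ → ℤ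
cornerEntry d c D = if D ≡ᵇ d then c else + 0

cornerEntry-≢ : ∀ {d} c {D} → D ≢ d → cornerEntry d c D ≡ + 0
cornerEntry-≢ {d} c {D} D≢d with D ≡ᵇ d in eq
... | true  = ⊥-elim (D≢d (ℕ.≡ᵇ⇒≡ D d (subst Bool.T (sym eq) _)))
... | false = refl

cornerEntry-self : ∀ d c → cornerEntry d c d ≡ c
cornerEntry-self d c with d ≡ᵇ d | ℕ.≡⇒≡ᵇ d d refl
... | true  | _  = refl
... | false | ()

pathWithCorners : ℤ → ℤ → (d : ℕ) → Mat (suc d)
pathWithCorners x c d = symToeplitz (λ D → pathEntry x D + cornerEntry d c D)

charPoly-AD-path : ∀ m x → let d = suc (suc m) in
  charPoly (suc d) (AD (suc d) (pathDist (suc d))) x ≡ det (suc d) (pathWithCorners x (- + d) d)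
charPoly-AD-path m x = det-cong (suc d) _ _ λ i j → let D = pathDist (suc d) i j in
  trans (cong₂ (λ b δ → (if b then x else + 0) - (if D ≡ᵇ 1 then + 1 else (if D ≡ᵇ δ then + δ else + 0)))
               (⌊i≟j⌋≡∣i-j∣≡ᵇ0 i j) (diameter-path d))
        (entry D)
  where
  d : ℕ
  d = suc (suc m)
  entry : ∀ D → (if D ≡ᵇ 0 then x else + 0) - (if D ≡ᵇ 1 then + 1 else (if D ≡ᵇ d then + d else + 0))
                ≡ pathEntry x D + cornerEntry d (- + d) D
  entry 0 = refl
  entry 1 = refl
  entry (suc (suc e)) with suc (suc e) ≡ᵇ d
  ... | true  = refl
  ... | false = refl

charPoly-AD-P₂ : ∀ x → charPoly 2 (AD 2 (pathDist 2)) x ≡ x * x - + 1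
charPoly-AD-P₂ x = trans (det-2 (λ i j → (if ⌊ i ≟ j ⌋ then x else + 0) - AD 2 (pathDist 2) i j)) (square x)
  where
  square : ∀ x → (x - + 0) * (x - + 0) - (+ 0 - + 1) * (+ 0 - + 1) ≡ x * x - + 1
  square = solve-∀

module PathWithCorners (x c : ℤ) (m : ℕ) where

  d : ℕ
  d = suc (suc m)

  E : ℕ → ℤ
  E D = pathEntry x D + cornerEntry d c D

  E-near : ∀ {D} → D < d → E D ≡ pathEntry x D
  E-near {D} D<d = trans (cong (_+_ (pathEntry x D)) (cornerEntry-≢ c (ℕ.<⇒≢ D<d))) (ℤ.+-identityʳ _)

  E-far : ∀ {D} → 2 ≤ D → D < d → E D ≡ + 0
  E-far 2≤D D<d = trans (E-near D<d) (pathEntry-≥2 x 2≤D)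

  T P M : Mat (suc d)
  T = symToeplitz (pathEntry x)
  P = symToeplitz (cornerEntry d c)
  M = pathWithCorners x c d

  A B : Mat (suc d)
  A i zero    = T i zero
  A i (suc j) = M i (suc j)
  B i zero    = P i zero
  B i (suc j) = M i (suc j)

  det-M : det (suc d) M ≡ det (suc d) A + det (suc d) B
  det-M = det-col₀-additive d M A B (λ _ → refl) (λ _ _ → refl) (λ _ _ → refl)

  Q : Mat d
  Q = minor (fromℕ d) zero B

  det-B : det (suc d) B ≡ sgn d * c * det d Q
  det-B = begin
    det (suc d) B                                   ≡⟨ det-col₀-single d B (fromℕ d) col₀≗0 ⟩
    sgn (toℕ (fromℕ d)) * B (fromℕ d) zero * det d Q ≡⟨ cong₂ (λ k b → sgn k * b * det d Q) (toℕ-fromℕ d) corner ⟩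
    sgn d * c * det d Q                             ∎
    where
    open ≡-Reasoning
    col₀≗0 : ∀ i → i ≢ fromℕ d → B i zero ≡ + 0
    col₀≗0 i i≢d = cornerEntry-≢ c λ eq →
      i≢d (toℕ-injective (trans (trans (sym (ℕ.∣-∣-identityʳ (toℕ i))) eq) (sym (toℕ-fromℕ d))))
    corner : B (fromℕ d) zero ≡ c
    corner = trans (cong (cornerEntry d c) (trans (ℕ.∣-∣-identityʳ _) (toℕ-fromℕ d))) (cornerEntry-self d c)

  Qa Qb : Mat d
  Qa zero    j = T zero (suc j)
  Qa (suc i) j = Q (suc i) j
  Qb zero    j = P zero (suc j)
  Qb (suc i) j = Q (suc i) j

  det-Q : det d Q ≡ det d Qa + det d Qb
  det-Q = det-row₀-additive (suc m) Q Qa Qb (λ _ → refl) (λ _ _ → refl) (λ _ _ → refl)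

  det-Qa : det d Qa ≡ (- + 1) ^ d
  det-Qa = det-lowerTriangular d Qa (- + 1) upper≗0 diag≗-1
    where
    upper≗0 : ∀ i j → toℕ i < toℕ j → Qa i j ≡ + 0
    upper≗0 zero    (suc j) _   = refl
    upper≗0 (suc i) j       i<j = E-far
      (2+m≤n⇒2≤∣m-n∣ (subst (λ a → 2 ℕ.+ a ≤ toℕ j) (sym (toℕ-punchIn-fromℕ i)) i<j))
      (∣i-j∣<n (punchIn (fromℕ (suc m)) i) j)
    diag≗-1 : ∀ i → Qa i i ≡ - + 1
    diag≗-1 zero    = refl
    diag≗-1 (suc i) = cong E (trans (cong (λ a → ∣ a - suc (toℕ i) ∣) (toℕ-punchIn-fromℕ i)) (∣n-1+n∣≡1 (toℕ i)))

  det-Qb : det d Qb ≡ sgn (suc m) * c * Φ (suc m) x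
  det-Qb = begin
    det d Qb
      ≡⟨ det-row₀-single (suc m) Qb (fromℕ (suc m)) row₀≗0 ⟩
    sgn (toℕ (fromℕ (suc m))) * Qb zero (fromℕ (suc m)) * det (suc m) (minor zero (fromℕ (suc m)) Qb)
      ≡⟨ cong₂ (λ k b → sgn k * b * det (suc m) (minor zero (fromℕ (suc m)) Qb)) (toℕ-fromℕ (suc m)) corner ⟩
    sgn (suc m) * c * det (suc m) (minor zero (fromℕ (suc m)) Qb)
      ≡⟨ cong (sgn (suc m) * c *_) (trans (det-cong (suc m) _ _ minor≗T) (sym (Φ≡det-pathEntry (suc m) x))) ⟩
    sgn (suc m) * c * Φ (suc m) x ∎
    where
    open ≡-Reasoning
    row₀≗0 : ∀ j → j ≢ fromℕ (suc m) → Qb zero j ≡ + 0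
    row₀≗0 j j≢m = cornerEntry-≢ c λ eq →
      j≢m (toℕ-injective (trans (ℕ.suc-injective eq) (sym (toℕ-fromℕ (suc m)))))
    corner : Qb zero (fromℕ (suc m)) ≡ c
    corner = trans (cong (cornerEntry d c ∘ suc) (toℕ-fromℕ (suc m))) (cornerEntry-self d c)
    minor≗T : ∀ r j → minor zero (fromℕ (suc m)) Qb r j ≡ symToeplitz (pathEntry x) r j
    minor≗T r j = trans (cong₂ (λ a b → E ∣ a - b ∣) (toℕ-punchIn-fromℕ r) (toℕ-punchIn-fromℕ j))
                        (E-near (ℕ.m<n⇒m<1+n (∣i-j∣<n r j)))

  B₂ : Mat (suc d)
  B₂ zero    j = P zero j
  B₂ (suc i) j = A (suc i) j

  det-A : det (suc d) A ≡ det (suc d) T + det (suc d) B₂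
  det-A = det-row₀-additive d A T B₂ row₀ below (λ _ _ → refl)
    where
    row₀ : ∀ j → A zero j ≡ T zero j + B₂ zero j
    row₀ zero    = sym (ℤ.+-identityʳ x)
    row₀ (suc j) = refl
    below : ∀ i j → A (suc i) j ≡ T (suc i) j
    below i zero    = refl
    below i (suc j) = E-near (∣i-j∣<n i j)

  det-B₂ : det (suc d) B₂ ≡ sgn d * c * (- + 1) ^ d
  det-B₂ = begin
    det (suc d) B₂
      ≡⟨ det-row₀-single d B₂ (fromℕ d) row₀≗0 ⟩
    sgn (toℕ (fromℕ d)) * B₂ zero (fromℕ d) * det d (minor zero (fromℕ d) B₂)
      ≡⟨ cong₂ (λ k b → sgn k * b * det d (minor zero (fromℕ d) B₂)) (toℕ-fromℕ d) corner ⟩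
    sgn d * c * det d (minor zero (fromℕ d) B₂)
      ≡⟨ cong (sgn d * c *_) (det-upperTriangular d (minor zero (fromℕ d) B₂) (- + 1) lower≗0 diag≗-1) ⟩
    sgn d * c * (- + 1) ^ d ∎
    where
    open ≡-Reasoning
    row₀≗0 : ∀ j → j ≢ fromℕ d → B₂ zero j ≡ + 0
    row₀≗0 j j≢d = cornerEntry-≢ c λ eq → j≢d (toℕ-injective (trans eq (sym (toℕ-fromℕ d))))
    corner : B₂ zero (fromℕ d) ≡ c
    corner = trans (cong (cornerEntry d c) (toℕ-fromℕ d)) (cornerEntry-self d c)
    lower≗0 : ∀ r j → toℕ j < toℕ r → minor zero (fromℕ d) B₂ r j ≡ + 0
    lower≗0 (suc r) zero    _   = refl
    lower≗0 r       (suc j) j<r = E-far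
      (subst (2 ≤_) (ℕ.∣-∣-comm (toℕ (punchIn (fromℕ (suc m)) j)) (toℕ r))
        (2+m≤n⇒2≤∣m-n∣ (subst (λ a → 2 ℕ.+ a ≤ toℕ r) (sym (toℕ-punchIn-fromℕ j)) j<r)))
      (∣i-j∣<n r (punchIn (fromℕ (suc m)) j))
    diag≗-1 : ∀ r → minor zero (fromℕ d) B₂ r r ≡ - + 1
    diag≗-1 zero    = refl
    diag≗-1 (suc r) = cong E (trans (cong (λ a → ∣ suc (toℕ r) - a ∣) (toℕ-punchIn-fromℕ r))
                                    (trans (ℕ.∣-∣-comm (suc (toℕ r)) (toℕ r)) (∣n-1+n∣≡1 (toℕ r))))

  det-pathWithCorners : det (suc d) M ≡ Φ (suc d) x - c * c * Φ (suc m) x + + 2 * c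
  det-pathWithCorners = begin
    det (suc d) M
      ≡⟨ det-M ⟩
    det (suc d) A + det (suc d) B
      ≡⟨ cong₂ _+_ det-A det-B ⟩
    (det (suc d) T + det (suc d) B₂) + sgn d * c * det d Q
      ≡⟨ cong₂ (λ t q → (t + det (suc d) B₂) + sgn d * c * q) (sym (Φ≡det-pathEntry (suc d) x)) det-Q ⟩
    (Φ (suc d) x + det (suc d) B₂) + sgn d * c * (det d Qa + det d Qb)
      ≡⟨ cong₂ (λ b q → (Φ (suc d) x + b) + sgn d * c * q) det-B₂ (cong₂ _+_ det-Qa det-Qb) ⟩
    (Φ (suc d) x + s′ * c * (- + 1) ^ d) + s′ * c * ((- + 1) ^ d + s * c * Φ (suc m) x)
      ≡⟨ cong (λ t → (Φ (suc d) x + s′ * c * t) + s′ * c * (t + s * c * Φ (suc m) x)) (-1^n≡sgn d) ⟩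
    (Φ (suc d) x + s′ * c * s′) + s′ * c * (s′ + s * c * Φ (suc m) x)
      ≡⟨ collect (Φ (suc d) x) (Φ (suc m) x) s c ⟩
    Φ (suc d) x - c * c * Φ (suc m) x * (s * s) + + 2 * c * (s * s)
      ≡⟨ cong (λ t → Φ (suc d) x - c * c * Φ (suc m) x * t + + 2 * c * t) (sgn-*-sgn (suc m)) ⟩
    Φ (suc d) x - c * c * Φ (suc m) x * + 1 + + 2 * c * + 1
      ≡⟨ drop-ones (Φ (suc d) x) (Φ (suc m) x) c ⟩
    Φ (suc d) x - c * c * Φ (suc m) x + + 2 * c ∎
    where
    open ≡-Reasoning
    s s′ : ℤ
    s  = sgn (suc m)
    s′ = - s
    collect : ∀ a b s c → (a + (- s) * c * (- s)) + (- s) * c * ((- s) + s * c * b)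
                          ≡ a - c * c * b * (s * s) + + 2 * c * (s * s)
    collect = solve-∀
    drop-ones : ∀ a b c → a - c * c * b * + 1 + + 2 * c * + 1 ≡ a - c * c * b + + 2 * c
    drop-ones = solve-∀

mainTheorem1 :
    (∀ (x : ℤ) → charPoly 2 (AD 2 (pathDist 2)) x ≡ x * x - + 1)
    × (∀ (n : ℕ) → 3 ≤ n → ∀ (x : ℤ) →
        charPoly n (AD n (pathDist n)) x
          ≡ Φ n x - (+ (n ∸ 1)) * (+ (n ∸ 1)) * Φ (n ∸ 2) x + (+ 2) * (+ 1 - + n))
mainTheorem1 = charPoly-AD-P₂ , Pₙ
  where
  Pₙ : ∀ n → 3 ≤ n → ∀ x → charPoly n (AD n (pathDist n)) x
         ≡ Φ n x - (+ (n ∸ 1)) * (+ (n ∸ 1)) * Φ (n ∸ 2) x + (+ 2) * (+ 1 - + n)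
  Pₙ (suc (suc (suc m))) (s≤s (s≤s (s≤s _))) x = begin
    charPoly (suc d) (AD (suc d) (pathDist (suc d))) x
      ≡⟨ charPoly-AD-path m x ⟩
    det (suc d) (pathWithCorners x (- + d) d)
      ≡⟨ PathWithCorners.det-pathWithCorners x (- + d) m ⟩
    Φ (suc d) x - (- + d) * (- + d) * Φ (suc m) x + + 2 * (- + d)
      ≡⟨ negate-corner (Φ (suc d) x) (Φ (suc m) x) (+ d) ⟩
    Φ (suc d) x - + d * + d * Φ (suc m) x + + 2 * (+ 1 - (+ 1 + + d)) ∎
    where
    open ≡-Reasoning
    d : ℕ
    d = suc (suc m)
    negate-corner : ∀ a b z → a - (- z) * (- z) * b + + 2 * (- z) ≡ a - z * z * b + + 2 * (+ 1 - (+ 1 + z))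
    negate-corner = solve-∀
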